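{- Let $S$ be a set and let $\mathcal C=F^{\mathrm{LD}}_S$ be the free LD category on $S$. If two objects $Y',Y''$ of $\mathcal C$ are thin, then so is $Y'\otimes Y''$.
   Context: The free (unitless) LD category $F^{\mathrm{LD}}_S$ on $S$: objects are formal binary expressions built from elements of $S$ with two operations $\otimes,\odot$. Morphisms are generated by identities and components of $\alpha_{A,B,C}:A\otimes(B\otimes C)\to(A\otimes B)\otimes C$, $\alpha^{ -1}$, $\bar\alpha_{A,B,C}:A\odot(B\odot C)\to(A\odot B)\odot C$, $\bar\alpha^{ -1}$, $\delta^l_{A,B,C}:A\otimes(B\odot C)\to(A\otimes B)\odot C$, $\delta^r_{A,B,C}:(A\odot B)\otimes C\to A\odot(B\otimes C)$ under composition, $\otimes$, $\odot$, modulo exactly the relations making it a category with bifunctors $\otimes,\odot$, natural $\alpha,\bar\alpha,\delta^l,\delta^r$, $\alpha^{\pm1}$ and $\bar\alpha^{\pm1}$ mutually inverse, and the pentagon axioms (objects denote identities): (P1) $\alpha_{A\otimes B,C,D}\circ\alpha_{A,B,C\otimes D}=(\alpha_{A,B,C}\otimes D)\circ\alpha_{A,B\otimes C,D}\circ(A\otimes\alpha_{B,C,D})$; (P2) $\delta^l_{A\otimes B,C,D}\circ\alpha_{A,B,C\odot D}=(\alpha_{A,B,C}\odot D)\circ\delta^l_{A,B\otimes C,D}\circ(A\otimes\delta^l_{B,C,D})$; (P3) $\delta^l_{A,B,C\otimes D}\circ(A\otimes\delta^r_{B,C,D})=\delta^r_{A\otimes B,C,D}\circ(\delta^l_{A,B,C}\otimes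 D)\circ\alpha_{A,B\odot C,D}$; (P4) $\bar\alpha_{A\otimes B,C,D}\circ\delta^l_{A,B,C\odot D}=(\delta^l_{A,B,C}\odot D)\circ\delta^l_{A,B\odot C,D}\circ(A\otimes\bar\alpha_{B,C,D})$; (P5) $(A\odot\alpha_{B,C,D})\circ\delta^r_{A,B,C\otimes D}=\delta^r_{A,B\otimes C,D}\circ(\delta^r_{A,B,C}\otimes D)\circ\alpha_{A\odot B,C,D}$; (P6) $(\delta^r_{A,B,C}\odot D)\circ\delta^l_{A\odot B,C,D}=\bar\alpha_{A,B\otimes C,D}\circ(A\odot\delta^l_{B,C,D})\circ\delta^r_{A,B,C\odot D}$; (P7) $\delta^r_{A\odot B,C,D}\circ(\bar\alpha_{A,B,C}\otimes D)=\bar\alpha_{A,B,C\otimes D}\circ(A\odot\delta^r_{B,C,D})\circ\delta^r_{A,B\odot C,D}$; (P8) $\bar\alpha_{A\odot B,C,D}\circ\bar\alpha_{A,B,C\odot D}=(\bar\alpha_{A,B,C}\odot D)\circ\bar\alpha_{A,B\odot C,D}\circ(A\odot\bar\alpha_{B,C,D})$. An object $Y$ is thin if for every object $X$ there is at most one morphism $X\to Y$. -}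

module Defs where

-- The free (unitless) LD category on a set S, presented syntactically:
-- objects are binary expressions, morphisms are formal terms, and the
-- morphisms of the category are terms modulo the congruence _≈_ below.

module FreeLD (S : Set) where

  infixr 30 _⊗_ _⊙_
  data Obj : Set where
    var : S → Obj
    _⊗_ : Obj → Obj → Obj
    _⊙_ : Obj → Obj → Obj

  infixr 20 _∘_
  infixr 30 _⊗₁_ _⊙₁_
  data Hom : Obj → Obj → Set where
    id   : ∀ {A} → Hom A A
    _∘_  : ∀ {A B C} → Hom B C → Hom A B → Hom A C
    _⊗₁_ : ∀ {A B C D} → Hom A B → Hom C D → Hom (A ⊗ C) (B ⊗ D)
    _⊙₁_ : ∀ {A B C D} → Hom A B → Hom C D → Hom (A ⊙ C) (B ⊙ D)
    α    : ∀ A B C → Hom (A ⊗ (B ⊗ C)) ((A ⊗ B) ⊗ C)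
    α⁻¹  : ∀ A B C → Hom ((A ⊗ B) ⊗ C) (A ⊗ (B ⊗ C))
    ᾱ    : ∀ A B C → Hom (A ⊙ (B ⊙ C)) ((A ⊙ B) ⊙ C)
    ᾱ⁻¹  : ∀ A B C → Hom ((A ⊙ B) ⊙ C) (A ⊙ (B ⊙ C))
    δl   : ∀ A B C → Hom (A ⊗ (B ⊙ C)) ((A ⊗ B) ⊙ C)
    δr   : ∀ A B C → Hom ((A ⊙ B) ⊗ C) (A ⊙ (B ⊗ C))

  ι : (A : Obj) → Hom A A
  ι A = id {A}

  infix 4 _≈_
  data _≈_ : ∀ {X Y} → Hom X Y → Hom X Y → Set where
    ≈-refl  : ∀ {X Y} {f : Hom X Y} → f ≈ f
    ≈-sym   : ∀ {X Y} {f g : Hom X Y} → f ≈ g → g ≈ f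
    ≈-trans : ∀ {X Y} {f g h : Hom X Y} → f ≈ g → g ≈ h → f ≈ h
    ∘-cong  : ∀ {X Y Z} {f f' : Hom Y Z} {g g' : Hom X Y} → f ≈ f' → g ≈ g' → f ∘ g ≈ f' ∘ g'
    ⊗-cong  : ∀ {A B C D} {f f' : Hom A B} {g g' : Hom C D} → f ≈ f' → g ≈ g' → f ⊗₁ g ≈ f' ⊗₁ g'
    ⊙-cong  : ∀ {A B C D} {f f' : Hom A B} {g g' : Hom C D} → f ≈ f' → g ≈ g' → f ⊙₁ g ≈ f' ⊙₁ g'
    idˡ     : ∀ {X Y} {f : Hom X Y} → id ∘ f ≈ f
    idʳ     : ∀ {X Y} {f : Hom X Y} → f ∘ id ≈ f
    assoc   : ∀ {W X Y Z} {f : Hom Y Z} {g : Hom X Y} {h : Hom W X} → (f ∘ g) ∘ h ≈ f ∘ (g ∘ h)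
    ⊗-id    : ∀ {A B} → ι A ⊗₁ ι B ≈ id
    ⊙-id    : ∀ {A B} → ι A ⊙₁ ι B ≈ id
    ⊗-∘     : ∀ {A B C D E F} {f : Hom B C} {g : Hom A B} {h : Hom E F} {k : Hom D E} →
              (f ∘ g) ⊗₁ (h ∘ k) ≈ (f ⊗₁ h) ∘ (g ⊗₁ k)
    ⊙-∘     : ∀ {A B C D E F} {f : Hom B C} {g : Hom A B} {h : Hom E F} {k : Hom D E} →
              (f ∘ g) ⊙₁ (h ∘ k) ≈ (f ⊙₁ h) ∘ (g ⊙₁ k)
    α-nat   : ∀ {A A' B B' C C'} (f : Hom A A') (g : Hom B B') (h : Hom C C') →
              ((f ⊗₁ g) ⊗₁ h) ∘ α A B C ≈ α A' B' C' ∘ (f ⊗₁ (g ⊗₁ h))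
    ᾱ-nat   : ∀ {A A' B B' C C'} (f : Hom A A') (g : Hom B B') (h : Hom C C') →
              ((f ⊙₁ g) ⊙₁ h) ∘ ᾱ A B C ≈ ᾱ A' B' C' ∘ (f ⊙₁ (g ⊙₁ h))
    δl-nat  : ∀ {A A' B B' C C'} (f : Hom A A') (g : Hom B B') (h : Hom C C') →
              ((f ⊗₁ g) ⊙₁ h) ∘ δl A B C ≈ δl A' B' C' ∘ (f ⊗₁ (g ⊙₁ h))
    δr-nat  : ∀ {A A' B B' C C'} (f : Hom A A') (g : Hom B B') (h : Hom C C') →
              (f ⊙₁ (g ⊗₁ h)) ∘ δr A B C ≈ δr A' B' C' ∘ ((f ⊙₁ g) ⊗₁ h)
    α-inv₁  : ∀ A B C → α⁻¹ A B C ∘ α A B C ≈ id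
    α-inv₂  : ∀ A B C → α A B C ∘ α⁻¹ A B C ≈ id
    ᾱ-inv₁  : ∀ A B C → ᾱ⁻¹ A B C ∘ ᾱ A B C ≈ id
    ᾱ-inv₂  : ∀ A B C → ᾱ A B C ∘ ᾱ⁻¹ A B C ≈ id
    P1 : ∀ A B C D → α (A ⊗ B) C D ∘ α A B (C ⊗ D)
                   ≈ (α A B C ⊗₁ ι D) ∘ α A (B ⊗ C) D ∘ (ι A ⊗₁ α B C D)
    P2 : ∀ A B C D → δl (A ⊗ B) C D ∘ α A B (C ⊙ D)
                   ≈ (α A B C ⊙₁ ι D) ∘ δl A (B ⊗ C) D ∘ (ι A ⊗₁ δl B C D)
    P3 : ∀ A B C D → δl A B (C ⊗ D) ∘ (ι A ⊗₁ δr B C D)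
                   ≈ δr (A ⊗ B) C D ∘ (δl A B C ⊗₁ ι D) ∘ α A (B ⊙ C) D
    P4 : ∀ A B C D → ᾱ (A ⊗ B) C D ∘ δl A B (C ⊙ D)
                   ≈ (δl A B C ⊙₁ ι D) ∘ δl A (B ⊙ C) D ∘ (ι A ⊗₁ ᾱ B C D)
    P5 : ∀ A B C D → (ι A ⊙₁ α B C D) ∘ δr A B (C ⊗ D)
                   ≈ δr A (B ⊗ C) D ∘ (δr A B C ⊗₁ ι D) ∘ α (A ⊙ B) C D
    P6 : ∀ A B C D → (δr A B C ⊙₁ ι D) ∘ δl (A ⊙ B) C D
                   ≈ ᾱ A (B ⊗ C) D ∘ (ι A ⊙₁ δl B C D) ∘ δr A B (C ⊙ D)
    P7 : ∀ A B C D → δr (A ⊙ B) C D ∘ (ᾱ A B C ⊗₁ ι D)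
                   ≈ ᾱ A B (C ⊗ D) ∘ (ι A ⊙₁ δr B C D) ∘ δr A (B ⊙ C) D
    P8 : ∀ A B C D → ᾱ (A ⊙ B) C D ∘ ᾱ A B (C ⊙ D)
                   ≈ (ᾱ A B C ⊙₁ ι D) ∘ ᾱ A (B ⊙ C) D ∘ (ι A ⊙₁ ᾱ B C D)

  Thin : Obj → Set
  Thin Y = ∀ X (f g : Hom X Y) → f ≈ g

{-# OPTIONS --safe #-}

-- A cut of an object Z is a ⊗-node reachable from the root of Z through ⊗-nodes
-- only; reassociating by α's at the cut gives split p : Z → L p ⊗ R p. Every
-- morphism k : X → Z is compatible with every cut p of Z: split p ∘ k factors as
-- (k₁ ⊗ k₂) ∘ split q for a cut q of X. This is checked generator by generator:
-- ᾱ, ᾱ⁻¹, δl, δr and ⊙₁ land in ⊙-rooted objects, which have no cuts, and α, α⁻¹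
-- only need naturality and the pentagon P1. Morphisms preserve the number of
-- variables, and a cut is determined by the number of variables to its left, so two
-- morphisms X → Y' ⊗ Y'' factor through the same cut of X, and thinness of Y' and
-- Y'' identifies the two pairs of factors.

module Submission where

open import Defs
open import Data.Nat using (ℕ; _+_; _<_; s≤s; z≤n)
open import Data.Nat.Properties
  using (+-assoc; +-cancelˡ-≡; <-irrefl; <-trans; <-≤-trans; m≤m+n; m<m+n; +-monoʳ-<)
open import Data.Empty using (⊥-elim)
open import Relation.Binary.PropositionalEquality using (_≡_; refl; sym; trans; cong; cong₂)

module FreeLDCuts (S : Set) where
  open FreeLD S

  infix  1 begin_
  infixr 2 _≈⟨_⟩_
  infix  3 _∎

  begin_ : ∀ {X Y} {f g : Hom X Y} → f ≈ g → f ≈ g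
  begin f≈g = f≈g

  _≈⟨_⟩_ : ∀ {X Y} (f : Hom X Y) {g h : Hom X Y} → f ≈ g → g ≈ h → f ≈ h
  _ ≈⟨ f≈g ⟩ g≈h = ≈-trans f≈g g≈h

  _∎ : ∀ {X Y} (f : Hom X Y) → f ≈ f
  _ ∎ = ≈-refl

  refl⟩∘⟨_ : ∀ {X Y Z} {f : Hom Y Z} {g g′ : Hom X Y} → g ≈ g′ → f ∘ g ≈ f ∘ g′
  refl⟩∘⟨_ = ∘-cong ≈-refl

  _⟩∘⟨refl : ∀ {X Y Z} {f f′ : Hom Y Z} {g : Hom X Y} → f ≈ f′ → f ∘ g ≈ f′ ∘ g
  f≈f′ ⟩∘⟨refl = ∘-cong f≈f′ ≈-refl

  sym-assoc : ∀ {W X Y Z} {f : Hom Y Z} {g : Hom X Y} {h : Hom W X} → f ∘ (g ∘ h) ≈ (f ∘ g) ∘ h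
  sym-assoc = ≈-sym assoc

  pullˡ : ∀ {W X Y Z} {f : Hom Y Z} {g : Hom X Y} {fg : Hom X Z} {h : Hom W X} →
          f ∘ g ≈ fg → f ∘ (g ∘ h) ≈ fg ∘ h
  pullˡ fg≈ = ≈-trans sym-assoc (fg≈ ⟩∘⟨refl)

  id-comm : ∀ {X Y} {f : Hom X Y} → f ∘ id ≈ id ∘ f
  id-comm = ≈-trans idʳ (≈-sym idˡ)

  ⊗ι-∘ : ∀ {A B C D} {f : Hom B C} {g : Hom A B} → (f ∘ g) ⊗₁ ι D ≈ (f ⊗₁ ι D) ∘ (g ⊗₁ ι D)
  ⊗ι-∘ = ≈-trans (⊗-cong ≈-refl (≈-sym idˡ)) ⊗-∘

  ι⊗-∘ : ∀ {A B C D} {f : Hom B C} {g : Hom A B} → ι D ⊗₁ (f ∘ g) ≈ (ι D ⊗₁ f) ∘ (ι D ⊗₁ g)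
  ι⊗-∘ = ≈-trans (⊗-cong (≈-sym idˡ) ≈-refl) ⊗-∘

  cancelˡ : ∀ {X Y Z} {a : Hom Y Z} {a⁻¹ : Hom Z Y} {f : Hom X Y} → a⁻¹ ∘ a ≈ id → a⁻¹ ∘ (a ∘ f) ≈ f
  cancelˡ inv = ≈-trans (pullˡ inv) idˡ

  cancelʳ : ∀ {X Y Z} {a : Hom X Y} {a⁻¹ : Hom Y X} {f : Hom Y Z} → a ∘ a⁻¹ ≈ id → (f ∘ a) ∘ a⁻¹ ≈ f
  cancelʳ inv = ≈-trans assoc (≈-trans (refl⟩∘⟨ inv) idʳ)

  ∘-inverse : ∀ {X Y Z} {a : Hom X Y} {a⁻¹ : Hom Y X} {b : Hom Y Z} {b⁻¹ : Hom Z Y} →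
              a⁻¹ ∘ a ≈ id → b⁻¹ ∘ b ≈ id → (a⁻¹ ∘ b⁻¹) ∘ (b ∘ a) ≈ id
  ∘-inverse a-inv b-inv = ≈-trans assoc (≈-trans (refl⟩∘⟨ cancelˡ b-inv) a-inv)

  ⊗-inverse : ∀ {A B C D} {f : Hom A B} {f⁻¹ : Hom B A} {g : Hom C D} {g⁻¹ : Hom D C} →
              f⁻¹ ∘ f ≈ id → g⁻¹ ∘ g ≈ id → (f⁻¹ ⊗₁ g⁻¹) ∘ (f ⊗₁ g) ≈ id
  ⊗-inverse f-inv g-inv = ≈-trans (≈-sym ⊗-∘) (≈-trans (⊗-cong f-inv g-inv) ⊗-id)

  flip-square : ∀ {W X Y Z} {a : Hom W X} {a⁻¹ : Hom X W} {b : Hom Y Z} {b⁻¹ : Hom Z Y}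
                  {x : Hom W Y} {y : Hom X Z} →
                a ∘ a⁻¹ ≈ id → b⁻¹ ∘ b ≈ id → y ∘ a ≈ b ∘ x → b⁻¹ ∘ y ≈ x ∘ a⁻¹
  flip-square {a = a} {a⁻¹} {b} {b⁻¹} {x} {y} a-inv b-inv square = begin
    b⁻¹ ∘ y               ≈⟨ refl⟩∘⟨ ≈-sym (cancelʳ a-inv) ⟩
    b⁻¹ ∘ ((y ∘ a) ∘ a⁻¹) ≈⟨ refl⟩∘⟨ (square ⟩∘⟨refl) ⟩
    b⁻¹ ∘ ((b ∘ x) ∘ a⁻¹) ≈⟨ refl⟩∘⟨ assoc ⟩
    b⁻¹ ∘ (b ∘ (x ∘ a⁻¹)) ≈⟨ cancelˡ b-inv ⟩
    x ∘ a⁻¹               ∎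

  α⁻¹-nat : ∀ {A A′ B B′ C C′} (f : Hom A A′) (g : Hom B B′) (h : Hom C C′) →
            α⁻¹ A′ B′ C′ ∘ ((f ⊗₁ g) ⊗₁ h) ≈ (f ⊗₁ (g ⊗₁ h)) ∘ α⁻¹ A B C
  α⁻¹-nat f g h = flip-square (α-inv₂ _ _ _) (α-inv₁ _ _ _) (α-nat f g h)

  pentagon-α⁻¹α⁻¹α : ∀ A B C D →
    α⁻¹ A (B ⊗ C) D ∘ ((α⁻¹ A B C ⊗₁ ι D) ∘ α (A ⊗ B) C D) ≈ (ι A ⊗₁ α B C D) ∘ α⁻¹ A B (C ⊗ D)
  pentagon-α⁻¹α⁻¹α A B C D =
    ≈-trans sym-assoc
      (flip-square (α-inv₂ _ _ _) (∘-inverse (α-inv₁ _ _ _) (⊗-inverse (α-inv₁ _ _ _) idˡ))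
                   (≈-trans (P1 A B C D) sym-assoc))

  pentagon-α⁻¹αα : ∀ A B C D →
    α⁻¹ (A ⊗ B) C D ∘ ((α A B C ⊗₁ ι D) ∘ α A (B ⊗ C) D) ≈ α A B (C ⊗ D) ∘ (ι A ⊗₁ α⁻¹ B C D)
  pentagon-α⁻¹αα A B C D =
    flip-square (⊗-inverse idˡ (α-inv₂ _ _ _)) (α-inv₁ _ _ _)
                (≈-trans assoc (≈-sym (P1 A B C D)))

  size : Obj → ℕ
  size (var _) = 1
  size (A ⊗ B) = size A + size B
  size (A ⊙ B) = size A + size B

  size-preserved : ∀ {X Y} → Hom X Y → size X ≡ size Y
  size-preserved id          = refl
  size-preserved (f ∘ g)     = trans (size-preserved g) (size-preserved f)
  size-preserved (f ⊗₁ g)    = cong₂ _+_ (size-preserved f) (size-preserved g)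
  size-preserved (f ⊙₁ g)    = cong₂ _+_ (size-preserved f) (size-preserved g)
  size-preserved (α A B C)   = sym (+-assoc (size A) (size B) (size C))
  size-preserved (α⁻¹ A B C) = +-assoc (size A) (size B) (size C)
  size-preserved (ᾱ A B C)   = sym (+-assoc (size A) (size B) (size C))
  size-preserved (ᾱ⁻¹ A B C) = +-assoc (size A) (size B) (size C)
  size-preserved (δl A B C)  = sym (+-assoc (size A) (size B) (size C))
  size-preserved (δr A B C)  = +-assoc (size A) (size B) (size C)

  size-positive : ∀ X → 0 < size X
  size-positive (var _) = s≤s z≤n
  size-positive (A ⊗ B) = <-≤-trans (size-positive A) (m≤m+n (size A) (size B))
  size-positive (A ⊙ B) = <-≤-trans (size-positive A) (m≤m+n (size A) (size B))

  data Cut : Obj → Set where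
    here  : ∀ {A B} → Cut (A ⊗ B)
    left  : ∀ {A B} → Cut A → Cut (A ⊗ B)
    right : ∀ {A B} → Cut B → Cut (A ⊗ B)

  L R : ∀ {X} → Cut X → Obj
  L (here {A})       = A
  L (left p)         = L p
  L (right {A} p)    = A ⊗ L p
  R (here {B = B})   = B
  R (left {B = B} p) = R p ⊗ B
  R (right p)        = R p

  split : ∀ {X} (p : Cut X) → Hom X (L p ⊗ R p)
  split here             = id
  split (left {B = B} p) = α⁻¹ (L p) (R p) B ∘ (split p ⊗₁ ι B)
  split (right {A} p)    = α A (L p) (R p) ∘ (ι A ⊗₁ split p)

  leftSize : ∀ {X} → Cut X → ℕ
  leftSize p = size (L p)

  leftSize<size : ∀ {X} (p : Cut X) → leftSize p < size X
  leftSize<size (here {A} {B})   = m<m+n (size A) (size-positive B)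
  leftSize<size (left {A} {B} p) = <-≤-trans (leftSize<size p) (m≤m+n (size A) (size B))
  leftSize<size (right {A} p)    = +-monoʳ-< (size A) (leftSize<size p)

  size<leftSize-right : ∀ {B} A (p : Cut B) → size A < leftSize (right {A} p)
  size<leftSize-right A p = m<m+n (size A) (size-positive (L p))

  leftSize-injective : ∀ {X} (p q : Cut X) → leftSize p ≡ leftSize q → p ≡ q
  leftSize-injective here      here      _ = refl
  leftSize-injective here      (left q)  e = ⊥-elim (<-irrefl (sym e) (leftSize<size q))
  leftSize-injective (here {A}) (right q) e = ⊥-elim (<-irrefl e (size<leftSize-right A q))
  leftSize-injective (left p)  here      e = ⊥-elim (<-irrefl e (leftSize<size p))
  leftSize-injective (left p)  (left q)  e = cong left (leftSize-injective p q e)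
  leftSize-injective (left {A} p) (right q) e =
    ⊥-elim (<-irrefl e (<-trans (leftSize<size p) (size<leftSize-right A q)))
  leftSize-injective (right {A} p) here e = ⊥-elim (<-irrefl (sym e) (size<leftSize-right A p))
  leftSize-injective (right {A} p) (left q) e =
    ⊥-elim (<-irrefl (sym e) (<-trans (leftSize<size q) (size<leftSize-right A p)))
  leftSize-injective (right {A} p) (right q) e =
    cong right (leftSize-injective p q (+-cancelˡ-≡ (size A) _ _ e))

  record Factorisation {X Z} (k : Hom X Z) (p : Cut Z) : Set where
    constructor factor
    field
      cut      : Cut X
      k₁       : Hom (L cut) (L p)
      k₂       : Hom (R cut) (R p)
      commutes : split p ∘ k ≈ (k₁ ⊗₁ k₂) ∘ split cut

  factorise-∘ : ∀ {X Y Z} {g : Hom Y Z} {f : Hom X Y} {p : Cut Z} →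
                Factorisation g p → (∀ q → Factorisation f q) → Factorisation (g ∘ f) p
  factorise-∘ {g = g} {f} {p} (factor q g₁ g₂ g-commutes) factorise-f
    with factorise-f q
  ... | factor r f₁ f₂ f-commutes = factor r (g₁ ∘ f₁) (g₂ ∘ f₂) (begin
    split p ∘ (g ∘ f)                    ≈⟨ sym-assoc ⟩
    (split p ∘ g) ∘ f                    ≈⟨ g-commutes ⟩∘⟨refl ⟩
    ((g₁ ⊗₁ g₂) ∘ split q) ∘ f           ≈⟨ assoc ⟩
    (g₁ ⊗₁ g₂) ∘ (split q ∘ f)           ≈⟨ refl⟩∘⟨ f-commutes ⟩
    (g₁ ⊗₁ g₂) ∘ ((f₁ ⊗₁ f₂) ∘ split r)  ≈⟨ sym-assoc ⟩
    ((g₁ ⊗₁ g₂) ∘ (f₁ ⊗₁ f₂)) ∘ split r  ≈⟨ ≈-sym ⊗-∘ ⟩∘⟨refl ⟩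
    ((g₁ ∘ f₁) ⊗₁ (g₂ ∘ f₂)) ∘ split r   ∎)

  factorise-⊗₁ˡ : ∀ {A A′ B B′} {f : Hom A A′} {p : Cut A′} (g : Hom B B′) →
                  Factorisation f p → Factorisation (f ⊗₁ g) (left p)
  factorise-⊗₁ˡ {B = B} {B′} {f} {p} g (factor q f₁ f₂ commutes) =
    factor (left q) f₁ (f₂ ⊗₁ g) (begin
      (α⁻¹ _ _ _ ∘ (split p ⊗₁ ι B′)) ∘ (f ⊗₁ g)         ≈⟨ assoc ⟩
      α⁻¹ _ _ _ ∘ ((split p ⊗₁ id) ∘ (f ⊗₁ g))           ≈⟨ refl⟩∘⟨ ≈-sym ⊗-∘ ⟩
      α⁻¹ _ _ _ ∘ ((split p ∘ f) ⊗₁ (id ∘ g))            ≈⟨ refl⟩∘⟨ ⊗-cong commutes (≈-sym id-comm) ⟩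
      α⁻¹ _ _ _ ∘ (((f₁ ⊗₁ f₂) ∘ split q) ⊗₁ (g ∘ id))   ≈⟨ refl⟩∘⟨ ⊗-∘ ⟩
      α⁻¹ _ _ _ ∘ (((f₁ ⊗₁ f₂) ⊗₁ g) ∘ (split q ⊗₁ id))  ≈⟨ pullˡ (α⁻¹-nat f₁ f₂ g) ⟩
      ((f₁ ⊗₁ (f₂ ⊗₁ g)) ∘ α⁻¹ _ _ _) ∘ (split q ⊗₁ id)  ≈⟨ assoc ⟩
      (f₁ ⊗₁ (f₂ ⊗₁ g)) ∘ (α⁻¹ _ _ _ ∘ (split q ⊗₁ ι B)) ∎)

  factorise-⊗₁ʳ : ∀ {A A′ B B′} {g : Hom B B′} {p : Cut B′} (f : Hom A A′) →
                  Factorisation g p → Factorisation (f ⊗₁ g) (right p)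
  factorise-⊗₁ʳ {A} {A′} {g = g} {p} f (factor q g₁ g₂ commutes) =
    factor (right q) (f ⊗₁ g₁) g₂ (begin
      (α _ _ _ ∘ (ι A′ ⊗₁ split p)) ∘ (f ⊗₁ g)           ≈⟨ assoc ⟩
      α _ _ _ ∘ ((id ⊗₁ split p) ∘ (f ⊗₁ g))             ≈⟨ refl⟩∘⟨ ≈-sym ⊗-∘ ⟩
      α _ _ _ ∘ ((id ∘ f) ⊗₁ (split p ∘ g))              ≈⟨ refl⟩∘⟨ ⊗-cong (≈-sym id-comm) commutes ⟩
      α _ _ _ ∘ ((f ∘ id) ⊗₁ ((g₁ ⊗₁ g₂) ∘ split q))     ≈⟨ refl⟩∘⟨ ⊗-∘ ⟩
      α _ _ _ ∘ ((f ⊗₁ (g₁ ⊗₁ g₂)) ∘ (id ⊗₁ split q))    ≈⟨ pullˡ (≈-sym (α-nat f g₁ g₂)) ⟩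
      (((f ⊗₁ g₁) ⊗₁ g₂) ∘ α _ _ _) ∘ (id ⊗₁ split q)    ≈⟨ assoc ⟩
      ((f ⊗₁ g₁) ⊗₁ g₂) ∘ (α _ _ _ ∘ (ι A ⊗₁ split q))   ∎)

  factorise-α : ∀ A B C (p : Cut ((A ⊗ B) ⊗ C)) → Factorisation (α A B C) p
  factorise-α A B C here = factor (right here) id id (begin
    id ∘ α A B C                   ≈⟨ idˡ ⟩
    α A B C                        ≈⟨ ≈-sym (≈-trans (refl⟩∘⟨ ⊗-id) idʳ) ⟩
    α A B C ∘ (ι A ⊗₁ id)          ≈⟨ ≈-sym (≈-trans (⊗-id ⟩∘⟨refl) idˡ) ⟩
    (id ⊗₁ id) ∘ α A B C ∘ (ι A ⊗₁ id) ∎)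
  factorise-α A B C (left here) = factor here id id (begin
    (α⁻¹ A B C ∘ (id ⊗₁ ι C)) ∘ α A B C ≈⟨ (≈-trans (refl⟩∘⟨ ⊗-id) idʳ) ⟩∘⟨refl ⟩
    α⁻¹ A B C ∘ α A B C                 ≈⟨ α-inv₁ A B C ⟩
    id                                  ≈⟨ ≈-sym (≈-trans idʳ ⊗-id) ⟩
    (id ⊗₁ id) ∘ id                     ∎)
  factorise-α A B C (left (left p)) = factor (left p) id (α (R p) B C) (begin
    (α⁻¹ _ _ _ ∘ ((α⁻¹ _ _ _ ∘ (split p ⊗₁ ι B)) ⊗₁ ι C)) ∘ α A B C
      ≈⟨ assoc ⟩
    α⁻¹ _ _ _ ∘ (((α⁻¹ _ _ _ ∘ (split p ⊗₁ ι B)) ⊗₁ ι C) ∘ α A B C)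
      ≈⟨ refl⟩∘⟨ (⊗ι-∘ ⟩∘⟨refl) ⟩
    α⁻¹ _ _ _ ∘ (((α⁻¹ _ _ _ ⊗₁ ι C) ∘ ((split p ⊗₁ ι B) ⊗₁ ι C)) ∘ α A B C)
      ≈⟨ refl⟩∘⟨ assoc ⟩
    α⁻¹ _ _ _ ∘ ((α⁻¹ _ _ _ ⊗₁ ι C) ∘ (((split p ⊗₁ ι B) ⊗₁ ι C) ∘ α A B C))
      ≈⟨ refl⟩∘⟨ refl⟩∘⟨ α-nat (split p) (ι B) (ι C) ⟩
    α⁻¹ _ _ _ ∘ ((α⁻¹ _ _ _ ⊗₁ ι C) ∘ (α _ _ _ ∘ (split p ⊗₁ (ι B ⊗₁ ι C))))
      ≈⟨ refl⟩∘⟨ sym-assoc ⟩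
    α⁻¹ _ _ _ ∘ (((α⁻¹ _ _ _ ⊗₁ ι C) ∘ α _ _ _) ∘ (split p ⊗₁ (ι B ⊗₁ ι C)))
      ≈⟨ pullˡ (pentagon-α⁻¹α⁻¹α (L p) (R p) B C) ⟩
    ((id ⊗₁ α _ _ _) ∘ α⁻¹ _ _ _) ∘ (split p ⊗₁ (ι B ⊗₁ ι C))
      ≈⟨ assoc ⟩
    (id ⊗₁ α _ _ _) ∘ (α⁻¹ _ _ _ ∘ (split p ⊗₁ (ι B ⊗₁ ι C)))
      ≈⟨ refl⟩∘⟨ refl⟩∘⟨ ⊗-cong ≈-refl ⊗-id ⟩
    (id ⊗₁ α _ _ _) ∘ (α⁻¹ _ _ _ ∘ (split p ⊗₁ ι (B ⊗ C)))
      ∎)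
  factorise-α A B C (left (right p)) = factor (right (left p)) id id (begin
    (α⁻¹ _ _ _ ∘ ((α _ _ _ ∘ (ι A ⊗₁ split p)) ⊗₁ ι C)) ∘ α A B C
      ≈⟨ assoc ⟩
    α⁻¹ _ _ _ ∘ (((α _ _ _ ∘ (ι A ⊗₁ split p)) ⊗₁ ι C) ∘ α A B C)
      ≈⟨ refl⟩∘⟨ (⊗ι-∘ ⟩∘⟨refl) ⟩
    α⁻¹ _ _ _ ∘ (((α _ _ _ ⊗₁ ι C) ∘ ((ι A ⊗₁ split p) ⊗₁ ι C)) ∘ α A B C)
      ≈⟨ refl⟩∘⟨ assoc ⟩
    α⁻¹ _ _ _ ∘ ((α _ _ _ ⊗₁ ι C) ∘ (((ι A ⊗₁ split p) ⊗₁ ι C) ∘ α A B C))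
      ≈⟨ refl⟩∘⟨ refl⟩∘⟨ α-nat (ι A) (split p) (ι C) ⟩
    α⁻¹ _ _ _ ∘ ((α _ _ _ ⊗₁ ι C) ∘ (α _ _ _ ∘ (ι A ⊗₁ (split p ⊗₁ ι C))))
      ≈⟨ refl⟩∘⟨ sym-assoc ⟩
    α⁻¹ _ _ _ ∘ (((α _ _ _ ⊗₁ ι C) ∘ α _ _ _) ∘ (ι A ⊗₁ (split p ⊗₁ ι C)))
      ≈⟨ pullˡ (pentagon-α⁻¹αα A (L p) (R p) C) ⟩
    (α _ _ _ ∘ (ι A ⊗₁ α⁻¹ _ _ _)) ∘ (ι A ⊗₁ (split p ⊗₁ ι C))
      ≈⟨ assoc ⟩
    α _ _ _ ∘ ((ι A ⊗₁ α⁻¹ _ _ _) ∘ (ι A ⊗₁ (split p ⊗₁ ι C)))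
      ≈⟨ refl⟩∘⟨ ≈-sym ι⊗-∘ ⟩
    α _ _ _ ∘ (ι A ⊗₁ (α⁻¹ _ _ _ ∘ (split p ⊗₁ ι C)))
      ≈⟨ ≈-sym (≈-trans (⊗-id ⟩∘⟨refl) idˡ) ⟩
    (id ⊗₁ id) ∘ (α _ _ _ ∘ (ι A ⊗₁ (α⁻¹ _ _ _ ∘ (split p ⊗₁ ι C))))
      ∎)
  factorise-α A B C (right p) = factor (right (right p)) (α A B (L p)) id (begin
    (α _ _ _ ∘ (ι (A ⊗ B) ⊗₁ split p)) ∘ α A B C
      ≈⟨ assoc ⟩
    α _ _ _ ∘ ((ι (A ⊗ B) ⊗₁ split p) ∘ α A B C)
      ≈⟨ refl⟩∘⟨ (⊗-cong (≈-sym ⊗-id) ≈-refl ⟩∘⟨refl) ⟩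
    α _ _ _ ∘ (((ι A ⊗₁ ι B) ⊗₁ split p) ∘ α A B C)
      ≈⟨ refl⟩∘⟨ α-nat (ι A) (ι B) (split p) ⟩
    α _ _ _ ∘ (α _ _ _ ∘ (ι A ⊗₁ (ι B ⊗₁ split p)))
      ≈⟨ pullˡ (P1 A B (L p) (R p)) ⟩
    ((α _ _ _ ⊗₁ id) ∘ (α _ _ _ ∘ (ι A ⊗₁ α _ _ _))) ∘ (ι A ⊗₁ (ι B ⊗₁ split p))
      ≈⟨ ≈-trans assoc (refl⟩∘⟨ assoc) ⟩
    (α _ _ _ ⊗₁ id) ∘ (α _ _ _ ∘ ((ι A ⊗₁ α _ _ _) ∘ (ι A ⊗₁ (ι B ⊗₁ split p))))
      ≈⟨ refl⟩∘⟨ refl⟩∘⟨ ≈-sym ι⊗-∘ ⟩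
    (α _ _ _ ⊗₁ id) ∘ (α _ _ _ ∘ (ι A ⊗₁ (α _ _ _ ∘ (ι B ⊗₁ split p))))
      ∎)

  invert-factorisation : ∀ {X Z} {a : Hom X Z} {a⁻¹ : Hom Z X} {p : Cut Z} (φ : Factorisation a p) →
                         let open Factorisation φ in
                         ∀ {k₁⁻¹ : Hom (L p) (L cut)} {k₂⁻¹ : Hom (R p) (R cut)} →
                         a ∘ a⁻¹ ≈ id → k₁⁻¹ ∘ k₁ ≈ id → k₂⁻¹ ∘ k₂ ≈ id → Factorisation a⁻¹ cut
  invert-factorisation {p = p} (factor _ k₁ k₂ commutes) {k₁⁻¹} {k₂⁻¹} a-inv k₁-inv k₂-inv =
    factor p k₁⁻¹ k₂⁻¹ (≈-sym (flip-square a-inv (⊗-inverse k₁-inv k₂-inv) commutes))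

  -- Each cut of A ⊗ (B ⊗ C) is the source cut of the factorisation of α at some cut
  -- of (A ⊗ B) ⊗ C, and the factors k₁, k₂ found there are invertible.
  factorise-α⁻¹ : ∀ A B C (p : Cut (A ⊗ (B ⊗ C))) → Factorisation (α⁻¹ A B C) p
  factorise-α⁻¹ A B C here =
    invert-factorisation (factorise-α A B C (left here)) (α-inv₂ A B C) idˡ idˡ
  factorise-α⁻¹ A B C (left p) =
    invert-factorisation (factorise-α A B C (left (left p))) (α-inv₂ A B C) idˡ (α-inv₁ _ _ _)
  factorise-α⁻¹ A B C (right here) =
    invert-factorisation (factorise-α A B C here) (α-inv₂ A B C) idˡ idˡ
  factorise-α⁻¹ A B C (right (left p)) =
    invert-factorisation (factorise-α A B C (left (right p))) (α-inv₂ A B C) idˡ idˡ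
  factorise-α⁻¹ A B C (right (right p)) =
    invert-factorisation (factorise-α A B C (right p)) (α-inv₂ A B C) (α-inv₁ _ _ _) idˡ

  factorise : ∀ {X Z} (k : Hom X Z) (p : Cut Z) → Factorisation k p
  factorise id p = factor p id id (≈-trans id-comm (≈-sym (⊗-id ⟩∘⟨refl)))
  factorise (g ∘ f) p = factorise-∘ (factorise g p) (factorise f)
  factorise (f ⊗₁ g) here = factor here f g (≈-sym id-comm)
  factorise (f ⊗₁ g) (left p) = factorise-⊗₁ˡ g (factorise f p)
  factorise (f ⊗₁ g) (right p) = factorise-⊗₁ʳ f (factorise g p)
  factorise (α A B C) p = factorise-α A B C p
  factorise (α⁻¹ A B C) p = factorise-α⁻¹ A B C p
  factorise (f ⊙₁ g) ()
  factorise (ᾱ A B C) ()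
  factorise (ᾱ⁻¹ A B C) ()
  factorise (δl A B C) ()
  factorise (δr A B C) ()

lemma5p3 : (S : Set) (Y' Y'' : FreeLD.Obj S) →
           FreeLD.Thin S Y' → FreeLD.Thin S Y'' → FreeLD.Thin S (FreeLD._⊗_ {S} Y' Y'')
lemma5p3 S Y′ Y″ thin′ thin″ X f g = agree (factorise f here) (factorise g here)
  where
  open FreeLD S
  open FreeLDCuts S

  agree : Factorisation f here → Factorisation g here → f ≈ g
  agree (factor q f₁ f₂ f-commutes) (factor q′ g₁ g₂ g-commutes)
    with leftSize-injective q q′ (trans (size-preserved f₁) (sym (size-preserved g₁)))
  ... | refl = begin
    f                    ≈⟨ ≈-sym idˡ ⟩
    id ∘ f               ≈⟨ f-commutes ⟩
    (f₁ ⊗₁ f₂) ∘ split q ≈⟨ ⊗-cong (thin′ _ f₁ g₁) (thin″ _ f₂ g₂) ⟩∘⟨refl ⟩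
    (g₁ ⊗₁ g₂) ∘ split q ≈⟨ ≈-sym g-commutes ⟩
    id ∘ g               ≈⟨ idˡ ⟩
    g                    ∎
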